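{- Let $\Sigma$ be a finite alphabet with $\sigma=|\Sigma|\ge 2$, let $k\ge 2$, and let $M$ be a minimum decycling set of the de Bruijn graph $D_k$. Then there exist $f,f'\in\Sigma^{k-1}$ such that $\mathrm{lc}(f)\subseteq M$ and $\mathrm{rc}(f')\subseteq M$.
   Context: The de Bruijn graph $D_k$ of order $k$ over $\Sigma$ has vertex set $\Sigma^k$ (the $k$-mers) and a directed edge $u\to v$ whenever the length-$(k-1)$ suffix of $u$ equals the length-$(k-1)$ prefix of $v$. A set $M\subseteq\Sigma^k$ is a decycling set if the graph $D_k\setminus M$ (delete the vertices of $M$) contains no directed cycle; a minimum decycling set (MDS) is a decycling set of minimum cardinality. For $f\in\Sigma^{k-1}$, the left-companions of $f$ are $\mathrm{lc}(f)=\{af: a\in\Sigma\}$ and the right-companions are $\mathrm{rc}(f)=\{fa: a\in\Sigma\}$ (juxtaposition denotes concatenation). -}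

module Defs where

open import Data.Nat using (ℕ; zero; suc; _+_; _≤_)
open import Data.Fin using (Fin)
open import Data.Vec using (Vec; []; _∷_; _∷ʳ_; init; tail)
open import Data.List using (List; []; _∷_; map; concatMap; length; filter)
open import Data.Bool using (Bool; true; false; T)
open import Data.List.Relation.Unary.All using (All)
open import Relation.Binary.PropositionalEquality using (_≡_)
open import Data.Product using (Σ; _×_; ∃)
open import Relation.Nullary using (¬_)

Word : ℕ → ℕ → Set
Word σ k = Vec (Fin σ) k

KSet : ℕ → ℕ → Set
KSet σ k = Word σ k → Bool

_∈ₛ_ : ∀ {σ k} → Word σ k → KSet σ k → Set
w ∈ₛ M = T (M w)

Edge : ∀ {σ k} → Word σ (suc k) → Word σ (suc k) → Set
Edge u v = tail u ≡ init v

-- A directed cycle in D_k \ M: a nonempty closed walk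
-- v₀ → v₁ → … → vₙ → v₀ all of whose vertices avoid M.
-- (A graph has a directed cycle iff it has a nonempty closed walk.)
EdgeChain : ∀ {σ k} → Word σ (suc k) → List (Word σ (suc k)) → Word σ (suc k) → Set
EdgeChain x [] first = Edge x first
EdgeChain x (y ∷ ys) first = Edge x y × EdgeChain y ys first

record CycleAvoiding {σ k} (M : KSet σ (suc k)) : Set where
  field
    start : Word σ (suc k)
    rest  : List (Word σ (suc k))
    closed : EdgeChain start rest start
    startAvoids : ¬ (start ∈ₛ M)
    restAvoids  : All (λ w → ¬ (w ∈ₛ M)) rest

Decycling : ∀ {σ k} → KSet σ (suc k) → Set
Decycling M = ¬ CycleAvoiding M

allFinL : (σ : ℕ) → List (Fin σ)
allFinL σ = Data.List.allFin σ

allWords : (σ k : ℕ) → List (Word σ k)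
allWords σ zero = [] ∷ []
allWords σ (suc k) = concatMap (λ a → map (a ∷_) (allWords σ k)) (allFinL σ)

card : ∀ {σ k} → KSet σ k → ℕ
card {σ} {k} M = length (filter (λ w → Data.Bool._≟_ (M w) true) (allWords σ k))

MinimumDecycling : ∀ {σ k} → KSet σ (suc k) → Set
MinimumDecycling {σ} {k} M =
  Decycling M × (∀ (N : KSet σ (suc k)) → Decycling N → card M ≤ card N)

lcSubset : ∀ {σ k} → Word σ k → KSet σ (suc k) → Set
lcSubset {σ} f M = ∀ (a : Fin σ) → (a ∷ f) ∈ₛ M

rcSubset : ∀ {σ k} → Word σ k → KSet σ (suc k) → Set
rcSubset {σ} f M = ∀ (a : Fin σ) → (f ∷ʳ a) ∈ₛ M

{-# OPTIONS --safe #-}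
-- If no left-companion class lc(f)
-- lies inside M, then every vertex has an in-neighbour outside M, so walking
-- backwards from any vertex stays in D_k \ M; among finitely many vertices the
-- walk repeats, which closes a cycle avoiding M. Right companions are dual, with
-- out-neighbours and forward walks.
module Submission where

open import Defs
open import Data.Nat using (ℕ; zero; suc; _≤_; _+_; _∸_; _^_)
open import Data.Nat.Properties using (n<1+n; m∸n+n≡m; +-suc)
open import Data.Fin using (Fin; toℕ; combine)
import Data.Fin.Properties as Finₚ
open import Data.Vec using ([]; _∷_; _∷ʳ_; init; tail; replicate)
open import Data.Vec.Properties using (init-∷ʳ)
open import Data.List using (applyUpTo; applyDownFrom)
open import Data.List.Relation.Unary.All.Properties using (applyUpTo⁺₂; applyDownFrom⁺₂)
open import Data.Product using (Σ; ∃₂; _×_; _,_; proj₁; proj₂)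
open import Data.Bool.Properties using (T?)
open import Function using (_∘_)
open import Relation.Binary.PropositionalEquality using (_≡_; refl; sym; trans; cong; subst)
open import Relation.Nullary using (¬_; Dec)
open import Relation.Nullary.Decidable using (map′; decidable-stable)

encode : ∀ {σ n} → Word σ n → Fin (σ ^ n)
encode []      = Fin.zero
encode (a ∷ w) = combine a (encode w)

encode-injective : ∀ {σ n} (u v : Word σ n) → encode u ≡ encode v → u ≡ v
encode-injective []      []      _ = refl
encode-injective (a ∷ u) (b ∷ v) eq with Finₚ.combine-injective a (encode u) b (encode v) eq
... | refl , encu≡encv = cong (a ∷_) (encode-injective u v encu≡encv)

sequence-repeats : ∀ {σ n} (g : ℕ → Word σ n) → ∃₂ λ i d → g i ≡ g (suc d + i)
sequence-repeats {σ} {n} g with Finₚ.pigeonhole (n<1+n (σ ^ n)) (encode ∘ g ∘ toℕ)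
... | i , j , i<j , eq =
  toℕ i , toℕ j ∸ suc (toℕ i) ,
  trans (encode-injective _ _ eq) (cong g (trans (sym (m∸n+n≡m i<j)) (+-suc _ (toℕ i))))

any-word? : ∀ {σ k} {P : Word σ k → Set} → (∀ w → Dec (P w)) → Dec (Σ (Word σ k) P)
any-word? {k = zero}  P? = map′ ([] ,_) (λ { ([] , p) → p }) (P? [])
any-word? {k = suc k} P? =
  map′ (λ (a , w , p) → a ∷ w , p) (λ { (a ∷ w , p) → a , w , p })
       (Finₚ.any? λ a → any-word? (λ w → P? (a ∷ w)))

module _ {σ k : ℕ} where

  backward-walk-chain : (g : ℕ → Word σ (suc k)) → (∀ m → Edge (g (suc m)) (g m)) →
    ∀ d → EdgeChain (g (suc d)) (applyDownFrom (g ∘ suc) d) (g 0)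
  backward-walk-chain g edge zero    = edge 0
  backward-walk-chain g edge (suc d) = edge (suc d) , backward-walk-chain g edge d

  forward-walk-chain : (g : ℕ → Word σ (suc k)) → (∀ m → Edge (g m) (g (suc m))) →
    ∀ d → EdgeChain (g 0) (applyUpTo (g ∘ suc) d) (g (suc d))
  forward-walk-chain g edge zero    = edge 0
  forward-walk-chain g edge (suc d) = edge 0 , forward-walk-chain (g ∘ suc) (edge ∘ suc) d

  module _ {M : KSet σ (suc k)} (g : ℕ → Word σ (suc k)) (avoids : ∀ m → ¬ g m ∈ₛ M) where

    backward-walk⇒cycle : (∀ m → Edge (g (suc m)) (g m)) → CycleAvoiding M
    backward-walk⇒cycle edge with sequence-repeats g
    ... | i , d , gᵢ≡gⱼ = record
      { start       = g (suc d + i)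
      ; rest        = applyDownFrom (λ j → g (suc j + i)) d
      ; closed      = subst (EdgeChain _ _) gᵢ≡gⱼ
                        (backward-walk-chain (λ m → g (m + i)) (λ m → edge (m + i)) d)
      ; startAvoids = avoids _
      ; restAvoids  = applyDownFrom⁺₂ _ d (λ _ → avoids _)
      }

    forward-walk⇒cycle : (∀ m → Edge (g m) (g (suc m))) → CycleAvoiding M
    forward-walk⇒cycle edge with sequence-repeats g
    ... | i , d , gᵢ≡gⱼ = record
      { start       = g i
      ; rest        = applyUpTo (λ j → g (suc j + i)) d
      ; closed      = subst (EdgeChain _ _) (sym gᵢ≡gⱼ)
                        (forward-walk-chain (λ m → g (m + i)) (λ m → edge (m + i)) d)
      ; startAvoids = avoids i
      ; restAvoids  = applyUpTo⁺₂ _ d (λ _ → avoids _)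
      }

  module _ {M : KSet σ (suc k)} where

    lcSubset? : (f : Word σ k) → Dec (lcSubset f M)
    lcSubset? f = Finₚ.all? λ a → T? (M (a ∷ f))

    rcSubset? : (f : Word σ k) → Dec (rcSubset f M)
    rcSubset? f = Finₚ.all? λ a → T? (M (f ∷ʳ a))

    ¬lcSubset⇒∃∉ : ∀ {f} → ¬ lcSubset f M → Σ (Fin σ) λ a → ¬ (a ∷ f) ∈ₛ M
    ¬lcSubset⇒∃∉ {f} = Finₚ.¬∀⟶∃¬ σ _ (λ a → T? (M (a ∷ f)))

    ¬rcSubset⇒∃∉ : ∀ {f} → ¬ rcSubset f M → Σ (Fin σ) λ a → ¬ (f ∷ʳ a) ∈ₛ M
    ¬rcSubset⇒∃∉ {f} = Finₚ.¬∀⟶∃¬ σ _ (λ a → T? (M (f ∷ʳ a)))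

    decycling⇒∃lcSubset : Fin σ → Decycling M → Σ (Word σ k) λ f → lcSubset f M
    decycling⇒∃lcSubset a decycling = decidable-stable (any-word? lcSubset?) ¬¬∃lcSubset
      where
      ¬¬∃lcSubset : ¬ ¬ Σ (Word σ k) λ f → lcSubset f M
      ¬¬∃lcSubset none = decycling (backward-walk⇒cycle walk avoids λ _ → refl)
        where
        missing : ∀ f → Σ (Fin σ) λ b → ¬ (b ∷ f) ∈ₛ M
        missing f = ¬lcSubset⇒∃∉ λ lc → none (f , lc)

        predecessor : Word σ (suc k) → Word σ (suc k)
        predecessor w = proj₁ (missing (init w)) ∷ init w

        walk : ℕ → Word σ (suc k)
        walk zero    = predecessor (replicate (suc k) a)
        walk (suc m) = predecessor (walk m)

        avoids : ∀ m → ¬ walk m ∈ₛ M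
        avoids zero    = proj₂ (missing _)
        avoids (suc m) = proj₂ (missing _)

    decycling⇒∃rcSubset : Fin σ → Decycling M → Σ (Word σ k) λ f → rcSubset f M
    decycling⇒∃rcSubset a decycling = decidable-stable (any-word? rcSubset?) ¬¬∃rcSubset
      where
      ¬¬∃rcSubset : ¬ ¬ Σ (Word σ k) λ f → rcSubset f M
      ¬¬∃rcSubset none = decycling (forward-walk⇒cycle walk avoids λ m → sym (init-∷ʳ _ _))
        where
        missing : ∀ f → Σ (Fin σ) λ b → ¬ (f ∷ʳ b) ∈ₛ M
        missing f = ¬rcSubset⇒∃∉ λ rc → none (f , rc)

        successor : Word σ (suc k) → Word σ (suc k)
        successor w = tail w ∷ʳ proj₁ (missing (tail w))

        walk : ℕ → Word σ (suc k)
        walk zero    = successor (replicate (suc k) a)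
        walk (suc m) = successor (walk m)

        avoids : ∀ m → ¬ walk m ∈ₛ M
        avoids zero    = proj₂ (missing _)
        avoids (suc m) = proj₂ (missing _)

proposition1 : (σ k : ℕ) → 2 ≤ σ → 1 ≤ k → (M : KSet σ (suc k)) → MinimumDecycling M →
    Σ (Word σ k) (λ f → Σ (Word σ k) (λ f′ → lcSubset f M × rcSubset f′ M))
proposition1 zero    k () _ M _
proposition1 (suc σ) k _  _ M (decycling , _)
  with decycling⇒∃lcSubset Fin.zero decycling | decycling⇒∃rcSubset Fin.zero decycling
... | f , lc | f′ , rc = f , f′ , lc , rc
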